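{- Let $P$ and $Q$ be well-founded posets and let $(\mathcal{I},\mathcal{F})$ be a cut for the poset $\mathrm{Pro}(P,Q)$, i.e. $\mathcal{I}$ is a down-set of $\mathrm{Pro}(P,Q)$ and $\mathcal{F}=\mathrm{Pro}(P,Q)\setminus\mathcal{I}$. Let $$\mathcal{A}=\{S\subseteq Q\times P \;:\; S\supseteq \Lambda f \text{ for some } f\in\mathcal{F}\},\qquad \mathcal{B}=\{S\subseteq Q\times P \;:\; S\cap \Gamma f=\emptyset \text{ for some } f\in\mathcal{I}\}.$$ Then $(\mathcal{B},\mathcal{A})$ is a cut for the Boolean lattice of all subsets of the set $Q\times P$: $\mathcal{B}$ is a down-set, $\mathcal{A}$ is an up-set, $\mathcal{A}\cap\mathcal{B}=\emptyset$ and $\mathcal{A}\cup\mathcal{B}$ consists of all subsets of $Q\times P$. Equivalently, for every subset $S\subseteq Q\times P$ exactly one of the following holds: $S$ contains $\Lambda f$ for some $f\in\mathcal{F}$, or the complement of $S$ contains $\Gamma f$ for some $f\in\mathcal{I}$.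
   Context: A poset is well-founded if every nonempty subset has a minimal element. For a poset $Q$, a down-set is a subset closed under taking smaller elements; $\widehat{Q}$ denotes the set of down-sets of $Q$ ordered by inclusion. For posets $P,Q$, a profunctor $f:P \to Q$ is an order-preserving map $f:P\to\widehat{Q}$ (so each $f(p)$ is a down-set of $Q$ and $p\le p'$ implies $f(p)\subseteq f(p')$). $\mathrm{Pro}(P,Q)$ is the set of profunctors, ordered by $f\le g$ iff $f(p)\subseteq g(p)$ for all $p$. A cut for a poset $X$ is a pair $(I,F)$ with $I$ a down-set and $F=X\setminus I$. The ascent of $f$ is $\Lambda f=\{(q,p)\in Q\times P : q\in f(p)\text{ and } q\notin f(p') \text{ for all } p'<p\}$, and the graph of $f$ is $\Gamma f=\{(q,p)\in Q\times P: q \text{ is a minimal element of } Q\setminus f(p)\}$. -}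

module Defs where

open import Level using (Level; _⊔_) renaming (suc to lsuc)
open import Data.Product using (Σ; ∃; _×_; _,_)
open import Data.Sum using (_⊎_)
open import Data.Empty using (⊥)
open import Relation.Nullary using (¬_)
open import Relation.Binary.PropositionalEquality using (_≡_)
open import Relation.Binary.Structures using (IsPartialOrder)

record Poset' (ℓ : Level) : Set (lsuc ℓ) where
  field
    Carrier        : Set ℓ
    _≤_            : Carrier → Carrier → Set ℓ
    isPartialOrder : IsPartialOrder _≡_ _≤_

  _<_ : Carrier → Carrier → Set ℓ
  x < y = (x ≤ y) × ¬ (x ≡ y)

Minimal : ∀ {ℓ} (P : Poset' ℓ) → (Poset'.Carrier P → Set ℓ) → Poset'.Carrier P → Set ℓ
Minimal P X x = X x × (∀ y → y < x → ¬ X y)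
  where open Poset' P

WellFounded' : ∀ {ℓ} → Poset' ℓ → Set (lsuc ℓ)
WellFounded' P = (X : Poset'.Carrier P → Set _) → ∃ X → ∃ (Minimal P X)

IsDownSet : ∀ {ℓ} (Q : Poset' ℓ) → (Poset'.Carrier Q → Set ℓ) → Set ℓ
IsDownSet Q D = ∀ {q q'} → q' ≤ q → D q → D q'
  where open Poset' Q

-- profunctors P → Q: order-preserving maps P → down-sets of Q
record Profunctor {ℓ} (P Q : Poset' ℓ) : Set (lsuc ℓ) where
  field
    app  : Poset'.Carrier P → Poset'.Carrier Q → Set ℓ
    down : ∀ p → IsDownSet Q (app p)
    mono : ∀ {p p'} → Poset'._≤_ P p p' → ∀ q → app p q → app p' q
open Profunctor public

_≤Pro_ : ∀ {ℓ} {P Q : Poset' ℓ} → Profunctor P Q → Profunctor P Q → Set ℓ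
_≤Pro_ {P = P} {Q} f g = ∀ p q → app f p q → app g p q

Rel : ∀ {ℓ} (Q P : Poset' ℓ) → Set (lsuc ℓ)
Rel {ℓ} Q P = Poset'.Carrier Q → Poset'.Carrier P → Set ℓ

_⊆R_ : ∀ {ℓ} {Q P : Poset' ℓ} → Rel Q P → Rel Q P → Set ℓ
S ⊆R T = ∀ q p → S q p → T q p

Ascent : ∀ {ℓ} {P Q : Poset' ℓ} → Profunctor P Q → Rel Q P
Ascent {P = P} f q p = app f p q × (∀ p' → Poset'._<_ P p' p → ¬ app f p' q)

Graph : ∀ {ℓ} {P Q : Poset' ℓ} → Profunctor P Q → Rel Q P
Graph {Q = Q} f q p = Minimal Q (λ y → ¬ app f p y) q

IsDownSetPro : ∀ {ℓ t} {P Q : Poset' ℓ} → (Profunctor P Q → Set t) → Set (lsuc ℓ ⊔ t)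
IsDownSetPro {P = P} {Q} 𝓘 = ∀ (f g : Profunctor P Q) → f ≤Pro g → 𝓘 g → 𝓘 f

𝓐 : ∀ {ℓ t} {P Q : Poset' ℓ} → (Profunctor P Q → Set t) → Rel Q P → Set (lsuc ℓ ⊔ t)
𝓐 {P = P} {Q} 𝓘 S = Σ (Profunctor P Q) λ f → ¬ 𝓘 f × (_⊆R_ {Q = Q} {P} (Ascent f) S)

𝓑 : ∀ {ℓ t} {P Q : Poset' ℓ} → (Profunctor P Q → Set t) → Rel Q P → Set (lsuc ℓ ⊔ t)
𝓑 {P = P} {Q} 𝓘 S = Σ (Profunctor P Q) λ f → 𝓘 f × (∀ q p → S q p → Graph f q p → ⊥)

IsCutOfSubsets : ∀ {ℓ u} {Q P : Poset' ℓ} → (Rel Q P → Set u) → (Rel Q P → Set u) → Set (lsuc ℓ ⊔ u)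
IsCutOfSubsets {Q = Q} {P} B A =
  (∀ (S T : Rel Q P) → _⊆R_ {Q = Q} {P} T S → B S → B T) ×
  (∀ (S T : Rel Q P) → _⊆R_ {Q = Q} {P} S T → A S → A T) ×
  (∀ (S : Rel Q P) → A S → B S → ⊥) ×
  (∀ (S : Rel Q P) → A S ⊎ B S)

{-# OPTIONS --safe #-}
-- If S ⊇ Λ f with f ∉ 𝓘 and S ∩ Γ g = ∅ with g ∈ 𝓘, then f ≰ g; taking p minimal and
-- then q minimal with q ∈ f(p) ∖ g(p) gives (q , p) ∈ Λ f ∩ Γ g ⊆ S ∩ Γ g, a contradiction.
-- Conversely, every S determines the least profunctor f_S in which q may enter f_S(p) afresh
-- only when (q , p) ∈ S: then Λ f_S ⊆ S and Γ f_S ∩ S = ∅, so S ∈ 𝓐 or S ∈ 𝓑 according as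
-- f_S ∉ 𝓘 or f_S ∈ 𝓘.
module Submission where

open import Defs
open import Level using (Level)
open import Axiom.ExcludedMiddle using (ExcludedMiddle)
open import Axiom.DoubleNegationElimination using (em⇒dne)
open import Data.Product using (∃; ∃₂; _×_; _,_; proj₁)
open import Data.Sum using (_⊎_; inj₁; inj₂)
open import Data.Empty using (⊥; ⊥-elim)
open import Relation.Nullary using (¬_; yes; no)
open import Relation.Binary.PropositionalEquality using (_≡_; refl)

≤⇒≡⊎< : ∀ {ℓ} → ExcludedMiddle ℓ → (R : Poset' ℓ) → ∀ {x y} →
        Poset'._≤_ R x y → x ≡ y ⊎ Poset'._<_ R x y
≤⇒≡⊎< lem R {x} {y} x≤y with lem {x ≡ y}
... | yes x≡y = inj₁ x≡y
... | no x≢y = inj₂ (x≤y , x≢y)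

module _ {ℓ} {P Q : Poset' ℓ} where
  open Poset' P using () renaming (Carrier to CP; _<_ to _<P_)
  open Poset' Q using () renaming (Carrier to CQ; _<_ to _<Q_)

  Exceeds : Profunctor P Q → Profunctor P Q → CP → CQ → Set ℓ
  Exceeds f g p q = app f p q × ¬ app g p q

  ≰Pro⇒exceeds : ExcludedMiddle ℓ → (f g : Profunctor P Q) →
                 ¬ f ≤Pro g → ∃₂ (Exceeds f g)
  ≰Pro⇒exceeds lem f g f≰g with lem {∃₂ (Exceeds f g)}
  ... | yes exceeds = exceeds
  ... | no ¬exceeds = ⊥-elim (f≰g λ p q fpq →
          em⇒dne lem λ ¬gpq → ¬exceeds (p , q , fpq , ¬gpq))

  ascent-meets-graph : WellFounded' P → WellFounded' Q → (f g : Profunctor P Q) →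
                       ∃₂ (Exceeds f g) → ∃₂ λ q p → Ascent f q p × Graph g q p
  ascent-meets-graph wfP wfQ f g (p₀ , q₀ , e₀)
    with wfP (λ p → ∃ (Exceeds f g p)) (p₀ , q₀ , e₀)
  ... | p , (q₁ , e₁) , p-minimal with wfQ (Exceeds f g p) (q₁ , e₁)
  ... | q , (fpq , ¬gpq) , q-minimal = q , p , (fpq , new) , (¬gpq , ¬¬g-below)
    where
    new : ∀ p' → p' <P p → ¬ app f p' q
    new p' p'<p fp'q =
      p-minimal p' p'<p (q , fp'q , λ gp'q → ¬gpq (mono g (proj₁ p'<p) q gp'q))

    ¬¬g-below : ∀ y → y <Q q → ¬ ¬ app g p y
    ¬¬g-below y y<q ¬gpy = q-minimal y y<q (down f p (proj₁ y<q) fpq , ¬gpy)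

module Generated {ℓ} (lem : ExcludedMiddle ℓ) {P Q : Poset' ℓ} (S : Rel Q P) where
  open Poset' P using () renaming (Carrier to CP; _≤_ to _≤P_; _<_ to _<P_)
  open Poset' Q using () renaming (Carrier to CQ; _<_ to _<Q_)

  data Gen : CP → CQ → Set ℓ where
    inherit : ∀ {p p' q} → p' <P p → Gen p' q → Gen p q
    admit   : ∀ {p q} → (∀ y → y <Q q → Gen p y) → S q p → Gen p q

  Gen-down : ∀ p → IsDownSet Q (Gen p)
  Gen-down p y≤q (inherit p'<p gen) = inherit p'<p (Gen-down _ y≤q gen)
  Gen-down p y≤q (admit below s) with ≤⇒≡⊎< lem Q y≤q
  ... | inj₁ refl = admit below s
  ... | inj₂ y<q = below _ y<q

  Gen-mono : ∀ {p p'} → p ≤P p' → ∀ q → Gen p q → Gen p' q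
  Gen-mono p≤p' q gen with ≤⇒≡⊎< lem P p≤p'
  ... | inj₁ refl = gen
  ... | inj₂ p<p' = inherit p<p' gen

  generated : Profunctor P Q
  generated = record { app = Gen ; down = Gen-down ; mono = Gen-mono }

  ascent-generated⊆ : _⊆R_ {Q = Q} {P} (Ascent generated) S
  ascent-generated⊆ q p (inherit p'<p gen , new) = ⊥-elim (new _ p'<p gen)
  ascent-generated⊆ q p (admit _ s , _) = s

  graph-generated-disjoint : ∀ q p → S q p → ¬ Graph generated q p
  graph-generated-disjoint q p s (¬gen , ¬¬gen-below) =
    ¬gen (admit (λ y y<q → em⇒dne lem (¬¬gen-below y y<q)) s)

open Generated using (generated; ascent-generated⊆; graph-generated-disjoint)

module _ {ℓ t} {P Q : Poset' ℓ} (𝓘 : Profunctor P Q → Set t) where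

  𝓑-downward : ∀ (S T : Rel Q P) → _⊆R_ {Q = Q} {P} T S → 𝓑 𝓘 S → 𝓑 𝓘 T
  𝓑-downward S T T⊆S (f , f∈𝓘 , S∩Γf=∅) =
    f , f∈𝓘 , λ q p Tqp → S∩Γf=∅ q p (T⊆S q p Tqp)

  𝓐-upward : ∀ (S T : Rel Q P) → _⊆R_ {Q = Q} {P} S T → 𝓐 𝓘 S → 𝓐 𝓘 T
  𝓐-upward S T S⊆T (f , f∉𝓘 , Λf⊆S) =
    f , f∉𝓘 , λ q p Λfqp → S⊆T q p (Λf⊆S q p Λfqp)

  𝓐∩𝓑≡∅ : ExcludedMiddle ℓ → WellFounded' P → WellFounded' Q → IsDownSetPro 𝓘 →
          ∀ (S : Rel Q P) → 𝓐 𝓘 S → 𝓑 𝓘 S → ⊥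
  𝓐∩𝓑≡∅ lem wfP wfQ 𝓘-down S (f , f∉𝓘 , Λf⊆S) (g , g∈𝓘 , S∩Γg=∅)
    with ascent-meets-graph wfP wfQ f g
           (≰Pro⇒exceeds lem f g λ f≤g → f∉𝓘 (𝓘-down f g f≤g g∈𝓘))
  ... | q , p , Λfqp , Γgqp = S∩Γg=∅ q p (Λf⊆S q p Λfqp) Γgqp

  𝓐∪𝓑-total : ExcludedMiddle ℓ → ExcludedMiddle t → ∀ (S : Rel Q P) → 𝓐 𝓘 S ⊎ 𝓑 𝓘 S
  𝓐∪𝓑-total lem lemₜ S with lemₜ {𝓘 (generated lem S)}
  ... | yes f∈𝓘 = inj₂ (generated lem S , f∈𝓘 , graph-generated-disjoint lem S)
  ... | no f∉𝓘 = inj₁ (generated lem S , f∉𝓘 , ascent-generated⊆ lem S)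

theorem3p7 : (lem : ∀ {a : Level} → ExcludedMiddle a)
    → ∀ {ℓ t} (P Q : Poset' ℓ) → WellFounded' P → WellFounded' Q
    → (𝓘 : Profunctor P Q → Set t) → IsDownSetPro 𝓘
    → IsCutOfSubsets {Q = Q} {P} (𝓑 𝓘) (𝓐 𝓘)
theorem3p7 lem P Q wfP wfQ 𝓘 𝓘-down =
  𝓑-downward 𝓘 , 𝓐-upward 𝓘 , 𝓐∩𝓑≡∅ 𝓘 lem wfP wfQ 𝓘-down , 𝓐∪𝓑-total 𝓘 lem lem
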